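{- Let $L$ be a finite lattice. If $L$ is join-congruence uniform and left modular, then $L$ is join-extremal. If $L$ is meet-congruence uniform and left modular, then $L$ is meet-extremal. If $L$ is congruence uniform, then $L$ is extremal if and only if $L$ is left modular.
   Context: For a convex subset $C$ of $L$, $I_L(C)=\{y\mid\exists x\in C,y\le x\}$ and the doubling $L[C]$ is the subposet of $L\times\{0<1\}$ on $(I_L(C)\times\{0\})\sqcup\big(((L\setminus I_L(C))\cup C)\times\{1\}\big)$. A lattice is join-congruence uniform (resp. meet-congruence uniform, congruence uniform) if it is obtained from the one-element lattice by finitely many successive doublings of nonempty lower pseudo-intervals (resp. upper pseudo-intervals, intervals); a lower (upper) pseudo-interval is a union of intervals sharing the same minimum (maximum). The length $\ell(L)$ is the maximum of $|F|-1$ over chains $F$. $L$ is join-extremal if $\ell(L)$ equals the number of join-irreducibles (elements covering exactly one element), meet-extremal if $\ell(L)$ equals the number of meet-irreducibles (elements covered by exactly one element), extremal if both. An element $a$ is left modular if for all $b<c$, $(b\vee a)\wedge c=b\vee(a\wedge c)$; $L$ is left modular if it has a maximal chain of left modular elements. -}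

module Defs where

open import Level using (0ℓ)
open import Data.Nat using (ℕ; suc)
import Data.Nat as ℕ
open import Data.Fin using (Fin)
import Data.Fin as F
open import Data.Fin.Subset using (Subset; _∈_)
open import Data.Bool using (Bool; true; false)
import Data.Bool as B
open import Data.List using (List; length)
import Data.List.Membership.Propositional as LM
open import Data.List.Relation.Unary.Unique.Propositional using (Unique)
open import Data.Product using (Σ; ∃; ∃₂; _×_; _,_)
open import Data.Sum using (_⊎_)
open import Relation.Nullary using (¬_)
open import Relation.Binary.PropositionalEquality using (_≡_; _≢_)
open import Relation.Binary.Structures using (IsPartialOrder)
open import Relation.Binary.Lattice.Structures using (IsLattice)
open import Function.Bundles using (_⇔_)

record FinPoset : Set₁ where
  field
    size           : ℕ
    _≤_            : Fin size → Fin size → Set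
    isPartialOrder : IsPartialOrder _≡_ _≤_

record FinLattice : Set₁ where
  field
    size      : ℕ
    _≤_       : Fin size → Fin size → Set
    _∨_       : Fin size → Fin size → Fin size
    _∧_       : Fin size → Fin size → Fin size
    isLattice : IsLattice _≡_ _≤_ _∨_ _∧_

  poset : FinPoset
  poset = record { size = size ; _≤_ = _≤_
                 ; isPartialOrder = IsLattice.isPartialOrder isLattice }

module _ (P : FinPoset) where
  open FinPoset P

  _<_ : Fin size → Fin size → Set
  x < y = x ≤ y × x ≢ y

  _⋖_ : Fin size → Fin size → Set
  y ⋖ x = y < x × (∀ z → ¬ (y < z × z < x))

  JoinIrreducible : Fin size → Set
  JoinIrreducible x = ∃ λ y → y ⋖ x × (∀ z → z ⋖ x → z ≡ y)

  MeetIrreducible : Fin size → Set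
  MeetIrreducible x = ∃ λ y → x ⋖ y × (∀ z → x ⋖ z → z ≡ y)

  CountIs : (Fin size → Set) → ℕ → Set
  CountIs Q k = Σ (List (Fin size)) λ xs →
    length xs ≡ k × Unique xs × (∀ x → (x LM.∈ xs) ⇔ Q x)

  Chain : ℕ → Set
  Chain k = Σ (Fin (suc k) → Fin size) λ c → ∀ i j → i F.< j → c i < c j

  LengthIs : ℕ → Set
  LengthIs k = Chain k × (∀ m → Chain m → m ℕ.≤ k)

  IsMaximalChain : (k : ℕ) → Chain k → Set
  IsMaximalChain k (c , _) =
    ∀ z → (∀ i → z ≤ c i ⊎ c i ≤ z) → ∃ λ i → c i ≡ z

  JoinExtremal : Set
  JoinExtremal = ∃ λ k → LengthIs k × CountIs JoinIrreducible k

  MeetExtremal : Set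
  MeetExtremal = ∃ λ k → LengthIs k × CountIs MeetIrreducible k

  Extremal : Set
  Extremal = JoinExtremal × MeetExtremal

  Ideal : (Fin size → Set) → Fin size → Set
  Ideal C y = ∃ λ x → C x × y ≤ x

  IsInterval : (Fin size → Set) → Set
  IsInterval C = ∃₂ λ a b → a ≤ b × (∀ x → C x ⇔ (a ≤ x × x ≤ b))

  IsLowerPseudoInterval : (Fin size → Set) → Set
  IsLowerPseudoInterval C = ∃₂ λ (m : Fin size) (T : Subset size) →
    (∃ λ t → t ∈ T × m ≤ t) ×
    (∀ x → C x ⇔ (m ≤ x × ∃ λ t → t ∈ T × x ≤ t))

  IsUpperPseudoInterval : (Fin size → Set) → Set
  IsUpperPseudoInterval C = ∃₂ λ (M : Fin size) (T : Subset size) →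
    (∃ λ t → t ∈ T × t ≤ M) ×
    (∀ x → C x ⇔ (x ≤ M × ∃ λ t → t ∈ T × t ≤ x))

  -- the underlying set of the doubling P[C] inside P × {0 < 1}
  InDoubling : (Fin size → Set) → Fin size × Bool → Set
  InDoubling C (x , false) = Ideal C x
  InDoubling C (x , true)  = ¬ Ideal C x ⊎ C x

  _≤×_ : Fin size × Bool → Fin size × Bool → Set
  (x , b) ≤× (y , c) = x ≤ y × b B.≤ c

IsoToDoubling : (Q P : FinPoset) → (Fin (FinPoset.size P) → Set) → Set
IsoToDoubling Q P C =
  Σ (Fin (FinPoset.size Q) → Fin (FinPoset.size P) × Bool) λ f →
    (∀ q → InDoubling P C (f q)) ×
    (∀ p → InDoubling P C p → ∃ λ q → f q ≡ p) ×
    (∀ q q′ → f q ≡ f q′ → q ≡ q′) ×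
    (∀ q q′ → FinPoset._≤_ Q q q′ ⇔ _≤×_ P (f q) (f q′))

data ObtainedByDoublings
       (Adm : (P : FinPoset) → (Fin (FinPoset.size P) → Set) → Set)
       : FinPoset → Set₁ where
  base : ∀ P → FinPoset.size P ≡ 1 → ObtainedByDoublings Adm P
  step : ∀ P Q (C : Fin (FinPoset.size P) → Set) →
         ObtainedByDoublings Adm P → Adm P C → IsoToDoubling Q P C →
         ObtainedByDoublings Adm Q

JoinCongruenceUniform : FinLattice → Set₁
JoinCongruenceUniform L =
  ObtainedByDoublings IsLowerPseudoInterval (FinLattice.poset L)

MeetCongruenceUniform : FinLattice → Set₁
MeetCongruenceUniform L =
  ObtainedByDoublings IsUpperPseudoInterval (FinLattice.poset L)

CongruenceUniform : FinLattice → Set₁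
CongruenceUniform L = ObtainedByDoublings IsInterval (FinLattice.poset L)

module _ (L : FinLattice) where
  open FinLattice L

  IsLeftModularElement : Fin size → Set
  IsLeftModularElement a =
    ∀ b c → _<_ poset b c → ((b ∨ a) ∧ c) ≡ (b ∨ (a ∧ c))

  LeftModular : Set
  LeftModular = ∃ λ k → Σ (Chain poset k) λ ch →
    IsMaximalChain poset k ch ×
    (∀ i → IsLeftModularElement (Data.Product.proj₁ ch i))

{-# OPTIONS --safe #-}

-- Doubling a convex set C keeps a lattice a lattice, computing joins and meets coordinatewise
-- and then moving them into the doubled set. Join-semidistributivity survives when C is
-- closed under meets (as lower pseudo-intervals are) and meet-semidistributivity when the
-- down-set of C is closed under joins (as for upper pseudo-intervals), so join- and
-- meet-congruence uniform lattices are join- resp. meet-semidistributive.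
--
-- Let c₀ ⋖ ⋯ ⋖ cₖ be a maximal chain of left modular elements. Each join-irreducible j
-- lies in exactly one step (j ≰ cᵢ, j ≤ cᵢ₊₁), and left modularity of cᵢ puts the lower
-- cover of j below cᵢ; then join-semidistributivity forbids two join-irreducibles in the
-- same step. Every step contains one, so there are exactly k, and k bounds the length of
-- every chain because distinct steps of a chain contain distinct join-irreducibles. The
-- meet-irreducible statement is the dual one.
--
-- Conversely, if a chain has as many steps as there are join-irreducibles, every
-- join-irreducible labels exactly one step, which makes the chain maximal. If the modular
-- law failed at cᵢ, it would fail across a cover B ⋖ C; its join-irreducible label j is
-- the label of some step at or above cᵢ, and meet-semidistributivity (uniqueness of κ(j))
-- identifies its meet-irreducible label with that of the step, which lies above cᵢ and B
-- and hence above C, a contradiction.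

module Submission where

open import Algebra.Core using (Op₂)
open import Data.Bool using (Bool; true; false; not; T; b≤b)
  renaming (_∨_ to _∨ᵇ_; _∧_ to _∧ᵇ_; _≤_ to _≤ᵇ_)
import Data.Bool.Properties as Boolₚ
open import Data.Empty using (⊥; ⊥-elim)
open import Data.Fin as Fin using (Fin; zero; suc; inject₁; fromℕ; _≟_)
import Data.Fin.Properties as Finₚ
open import Data.List using (tabulate; lookup)
open import Data.List.Properties using (length-tabulate)
open import Data.List.Membership.Propositional using (_∈_)
open import Data.List.Membership.Propositional.Properties using (∈-tabulate⁺; ∈-tabulate⁻)
import Data.List.Relation.Unary.Any as Any
open import Data.List.Relation.Unary.Any.Properties using (lookup-index)
open import Data.List.Relation.Unary.Unique.Propositional.Properties using (tabulate⁺)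
import Data.Nat as ℕ
import Data.Nat.Properties as ℕₚ
open import Data.Fin.Induction using (po-wellFounded; po-noetherian)
open import Induction.WellFounded using (Acc; acc)
open import Data.Fin.Subset using (⁅_⁆)
open import Data.Fin.Subset.Properties using (_∈?_; x∈⁅x⁆; x∈⁅y⁆⇒x≡y)
open import Data.Product using (∃; ∃₂; _×_; _,_; proj₁; proj₂)
open import Data.Product.Properties using (,-injectiveˡ; ,-injectiveʳ)
open import Data.Sum using (_⊎_; inj₁; inj₂; swap; [_,_])
open import Function.Base using (id; const; flip; _∘_)
open import Function.Bundles using (_⇔_; mk⇔; Equivalence)
open import Function.Properties.Equivalence using () renaming (trans to ⇔-trans)
open import Level using (0ℓ)
open import Relation.Binary.Lattice.Bundles using (Lattice)
open import Relation.Binary.Definitions using (Decidable; Antisymmetric; tri<; tri≈; tri>)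
open import Relation.Binary.Lattice.Definitions using (Supremum; Infimum)
open import Relation.Binary.Lattice.Structures using (IsLattice)
open import Relation.Binary.Structures using (IsPartialOrder)
import Relation.Binary.Construct.Flip.EqAndOrd as Flip
open import Relation.Binary.PropositionalEquality using (_≡_; _≢_; refl; sym; trans; cong; subst; subst₂)
open import Relation.Binary.PropositionalEquality.Properties using (module ≡-Reasoning)
open import Relation.Nullary using (¬_; yes; no; isYes)
open import Relation.Nullary.Decidable
  using (_×-dec_; _⊎-dec_; ¬?; map′; decidable-stable; True; toWitness; fromWitness)
import Relation.Unary as U

open import Defs hiding (_<_; _⋖_)

JoinSemidistributive : {A : Set} → Op₂ A → Op₂ A → Set
JoinSemidistributive _∨_ _∧_ = ∀ a b c → a ∨ b ≡ a ∨ c → a ∨ (b ∧ c) ≡ a ∨ b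

MeetSemidistributive : {A : Set} → Op₂ A → Op₂ A → Set
MeetSemidistributive _∨_ _∧_ = JoinSemidistributive _∧_ _∨_

module LatticeProperties (L : FinLattice) where

  open FinLattice L public
  open IsLattice isLattice public
    renaming (refl to ≤-refl; trans to ≤-trans; antisym to ≤-antisym; reflexive to ≤-reflexive)

  lattice : Lattice 0ℓ 0ℓ 0ℓ
  lattice = record { isLattice = isLattice }

  open import Relation.Binary.Lattice.Properties.JoinSemilattice (Lattice.joinSemilattice lattice) public
    using (∨-comm; x≤y⇒x∨y≈y; ≈-dec⇒≤-dec)
  open import Relation.Binary.Lattice.Properties.MeetSemilattice (Lattice.meetSemilattice lattice) public
    using (∧-comm; y≤x⇒x∧y≈y)
  open import Relation.Binary.Properties.Poset (Lattice.poset lattice) public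
    using (_<_; <-irrefl; <⇒≱)

  _⋖_ : Fin size → Fin size → Set
  _⋖_ = Defs._⋖_ poset

  _≤?_ : Decidable _≤_
  _≤?_ = ≈-dec⇒≤-dec _≟_

  _<?_ : Decidable _<_
  x <? y = x ≤? y ×-dec ¬? (x ≟ y)

  ≤-stable : ∀ {x y} → ¬ ¬ x ≤ y → x ≤ y
  ≤-stable {x} {y} = decidable-stable (x ≤? y)

  cover-above : ∀ {x y z} → y ⋖ x → y < z → z ≤ x → z ≡ x
  cover-above {x} {z = z} (_ , nothing-between) y<z z≤x with z ≟ x
  ... | yes z≡x = z≡x
  ... | no z≢x  = ⊥-elim (nothing-between z (y<z , z≤x , z≢x))

  cover-below : ∀ {x y z} → y ⋖ x → y ≤ z → z < x → z ≡ y
  cover-below {y = y} {z} (_ , nothing-between) y≤z z<x with z ≟ y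
  ... | yes z≡y = z≡y
  ... | no z≢y  = ⊥-elim (nothing-between z ((y≤z , z≢y ∘ sym) , z<x))

  x<x∨y : ∀ {x y} → ¬ y ≤ x → x < x ∨ y
  x<x∨y {x} {y} y≰x = x≤x∨y x y , λ x≡x∨y → y≰x (subst (y ≤_) (sym x≡x∨y) (y≤x∨y x y))

  x∧y<x : ∀ {x y} → ¬ x ≤ y → x ∧ y < x
  x∧y<x {x} {y} x≰y = x∧y≤x x y , λ x∧y≡x → x≰y (subst (_≤ y) x∧y≡x (x∧y≤y x y))

  x∧y<y : ∀ {x y} → ¬ y ≤ x → x ∧ y < y
  x∧y<y {x} {y} y≰x = x∧y≤y x y , λ x∧y≡y → y≰x (subst (_≤ x) x∧y≡y (x∧y≤x x y))

  y≤x⇒x∨y≡x : ∀ {x y} → y ≤ x → x ∨ y ≡ x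
  y≤x⇒x∨y≡x {x} {y} y≤x = trans (∨-comm x y) (x≤y⇒x∨y≈y y≤x)

  x≤y⇒x∧y≡x : ∀ {x y} → x ≤ y → x ∧ y ≡ x
  x≤y⇒x∧y≡x {x} {y} x≤y = trans (∧-comm x y) (y≤x⇒x∧y≈y x≤y)

  cover-join : ∀ {x y z} → y ⋖ x → ¬ z ≤ y → z ≤ x → y ∨ z ≡ x
  cover-join y⋖x z≰y z≤x = cover-above y⋖x (x<x∨y z≰y) (∨-least (proj₁ (proj₁ y⋖x)) z≤x)

  lowerCover-exists : ∀ {z x} → z < x → ∃ λ w → z ≤ w × w ⋖ x
  lowerCover-exists = go (po-noetherian isPartialOrder _)
    where
    go : ∀ {z x} → Acc (flip _<_) z → z < x → ∃ λ w → z ≤ w × w ⋖ x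
    go {z} {x} (acc rec) z<x with Finₚ.any? (λ w → z <? w ×-dec w <? x)
    ... | yes (w , z<w , w<x) =
      let v , w≤v , v⋖x = go (rec z<w) w<x in v , ≤-trans (proj₁ z<w) w≤v , v⋖x
    ... | no ∄w = z , ≤-refl , z<x , λ w z<w<x → ∄w (w , z<w<x)

  joinIrreducible-below : ∀ {j} (ji : JoinIrreducible poset j) → ∀ z → z < j → z ≤ proj₁ ji
  joinIrreducible-below (_ , _ , unique) z z<j =
    let w , z≤w , w⋖j = lowerCover-exists z<j in subst (z ≤_) (unique w w⋖j) z≤w

  MinimalNotBelow : Fin size → Fin size → Set
  MinimalNotBelow a j = ¬ j ≤ a × (∀ z → z < j → z ≤ a)

  minimalNotBelow-exists : ∀ {y a} → ¬ y ≤ a → ∃ λ j → j ≤ y × MinimalNotBelow a j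
  minimalNotBelow-exists = go (po-wellFounded isPartialOrder _)
    where
    go : ∀ {y a} → Acc _<_ y → ¬ y ≤ a → ∃ λ j → j ≤ y × MinimalNotBelow a j
    go {y} {a} (acc rec) y≰a with Finₚ.any? (λ z → z <? y ×-dec ¬? (z ≤? a))
    ... | yes (z , z<y , z≰a) =
      let j , j≤z , j-min = go (rec z<y) z≰a in j , ≤-trans j≤z (proj₁ z<y) , j-min
    ... | no ∄z = y , ≤-refl , y≰a , λ z z<y → ≤-stable (λ z≰a → ∄z (z , z<y , z≰a))

  minimalNotBelow⇒joinIrreducible : ∀ {a j} → MinimalNotBelow a j → JoinIrreducible poset j
  minimalNotBelow⇒joinIrreducible {a} {j} (j≰a , below-a) =
    let w , a∧j≤w , w⋖j = lowerCover-exists (x∧y<y j≰a)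
    in  w , w⋖j , λ z z⋖j →
          let z≤a∧j = ∧-greatest (below-a z (proj₁ z⋖j)) (proj₁ (proj₁ z⋖j))
          in  sym (cover-below z⋖j (≤-trans z≤a∧j a∧j≤w) (proj₁ w⋖j))

  joinIrreducible-separates : ∀ {y a} → ¬ y ≤ a → ∃ λ j → JoinIrreducible poset j × j ≤ y × ¬ j ≤ a
  joinIrreducible-separates y≰a =
    let j , j≤y , j-min = minimalNotBelow-exists y≰a
    in  j , minimalNotBelow⇒joinIrreducible j-min , j≤y , proj₁ j-min

dual : FinLattice → FinLattice
dual L = record
  { size = size ; _≤_ = flip _≤_ ; _∨_ = _∧_ ; _∧_ = _∨_
  ; isLattice = record
    { isPartialOrder = Flip.isPartialOrder isPartialOrder ; supremum = infimum ; infimum = supremum } }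
  where
  open FinLattice L
  open IsLattice isLattice using (isPartialOrder; supremum; infimum)

module DualProperties (L : FinLattice) where

  open LatticeProperties L
  private module Dual = LatticeProperties (dual L)

  >⇒<ᵈ : ∀ {x y} → y < x → x Dual.< y
  >⇒<ᵈ (y≤x , y≢x) = y≤x , y≢x ∘ sym

  <ᵈ⇒> : ∀ {x y} → x Dual.< y → y < x
  <ᵈ⇒> (y≤x , x≢y) = y≤x , x≢y ∘ sym

  ⋖ᵈ⇒⋗ : ∀ {x y} → x Dual.⋖ y → y ⋖ x
  ⋖ᵈ⇒⋗ (x<ᵈy , nothing-between) =
    <ᵈ⇒> x<ᵈy , λ z (y<z , z<x) → nothing-between z (>⇒<ᵈ z<x , >⇒<ᵈ y<z)

  ⋗⇒⋖ᵈ : ∀ {x y} → y ⋖ x → x Dual.⋖ y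
  ⋗⇒⋖ᵈ (y<x , nothing-between) =
    >⇒<ᵈ y<x , λ z (x<ᵈz , z<ᵈy) → nothing-between z (<ᵈ⇒> z<ᵈy , <ᵈ⇒> x<ᵈz)

  joinIrreducibleᵈ⇔meetIrreducible : ∀ x → JoinIrreducible (FinLattice.poset (dual L)) x ⇔ MeetIrreducible poset x
  joinIrreducibleᵈ⇔meetIrreducible x = mk⇔
    (λ (y , y⋖ᵈx , unique) → y , ⋖ᵈ⇒⋗ y⋖ᵈx , λ z x⋖z → unique z (⋗⇒⋖ᵈ x⋖z))
    (λ (y , x⋖y , unique) → y , ⋗⇒⋖ᵈ x⋖y , λ z z⋖ᵈx → unique z (⋖ᵈ⇒⋗ z⋖ᵈx))

  upperCover-exists : ∀ {x z} → x < z → ∃ λ w → x ⋖ w × w ≤ z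
  upperCover-exists x<z =
    let w , w≤z , w⋖ᵈx = Dual.lowerCover-exists (>⇒<ᵈ x<z) in w , ⋖ᵈ⇒⋗ w⋖ᵈx , w≤z

  MaximalNotAbove : Fin size → Fin size → Set
  MaximalNotAbove a m = ¬ a ≤ m × (∀ z → m < z → a ≤ z)

  maximalNotAbove-exists : ∀ {y a} → ¬ a ≤ y → ∃ λ m → y ≤ m × MaximalNotAbove a m
  maximalNotAbove-exists a≰y =
    let m , y≤m , a≰m , above-a = Dual.minimalNotBelow-exists a≰y
    in  m , y≤m , a≰m , λ z m<z → above-a z (>⇒<ᵈ m<z)

-- Doubling

-- The order proof of P is reused, so that FinLattice.poset (finLattice S) is P up to η.
record LatticeOn (P : FinPoset) : Set where
  open FinPoset P
  field
    _∨_      : Op₂ (Fin size)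
    _∧_      : Op₂ (Fin size)
    supremum : Supremum _≤_ _∨_
    infimum  : Infimum _≤_ _∧_

  finLattice : FinLattice
  finLattice = record
    { size = size ; _≤_ = _≤_ ; _∨_ = _∨_ ; _∧_ = _∧_
    ; isLattice = record
      { isPartialOrder = isPartialOrder ; supremum = supremum ; infimum = infimum } }

module _ (K : FinLattice) (C : Fin (FinLattice.size K) → Set) where
  open FinLattice K

  Convex : Set
  Convex = ∀ {x y} → C x → x ≤ y → Ideal poset C y → C y

  MeetClosed : Set
  MeetClosed = ∀ {x y} → C x → C y → C (x ∧ y)

  IdealJoinClosed : Set
  IdealJoinClosed = ∀ {x y} → Ideal poset C x → Ideal poset C y → Ideal poset C (x ∨ y)

boolIsLattice : IsLattice _≡_ _≤ᵇ_ _∨ᵇ_ _∧ᵇ_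
boolIsLattice = record
  { isPartialOrder = Boolₚ.≤-isPartialOrder ; supremum = ∨-supremum ; infimum = ∧-infimum }
  where
  ∨-supremum : Supremum _≤ᵇ_ _∨ᵇ_
  ∨-supremum true  y = b≤b , Boolₚ.≤-maximum y , λ _ t≤z _ → t≤z
  ∨-supremum false y = Boolₚ.≤-minimum y , b≤b , λ _ _ y≤z → y≤z

  ∧-infimum : Infimum _≤ᵇ_ _∧ᵇ_
  ∧-infimum true  y = Boolₚ.≤-maximum y , b≤b , λ _ _ z≤y → z≤y
  ∧-infimum false y = b≤b , Boolₚ.≤-minimum y , λ _ z≤f _ → z≤f

module BoolLattice = IsLattice boolIsLattice

-- The second coordinates of the semidistributive laws in a doubling L[C]: ι records whether
-- the join lies in I(C), δ whether the meet may lie in the upper copy.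
joinBit-semidistrib : ∀ ι δ e f g → (T ι → T f → T g → T δ) →
                      not ι ∨ᵇ (e ∨ᵇ f) ≡ not ι ∨ᵇ (e ∨ᵇ g) →
                      not ι ∨ᵇ (e ∨ᵇ (δ ∧ᵇ (f ∧ᵇ g))) ≡ not ι ∨ᵇ (e ∨ᵇ f)
joinBit-semidistrib false _     _     _     _     _    _  = refl
joinBit-semidistrib true  _     true  _     _     _    _  = refl
joinBit-semidistrib true  false false false _     _    _  = refl
joinBit-semidistrib true  true  false false _     _    _  = refl
joinBit-semidistrib true  true  false true  true  _    _  = refl
joinBit-semidistrib true  false false true  true  side _  = ⊥-elim (side _ _ _)
joinBit-semidistrib true  _     false true  false _    ()

meetBit-semidistrib : ∀ δ ι e f g → (T (not f) → T (not g) → T ι) →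
                      δ ∧ᵇ (e ∧ᵇ f) ≡ δ ∧ᵇ (e ∧ᵇ g) →
                      δ ∧ᵇ (e ∧ᵇ (not ι ∨ᵇ (f ∨ᵇ g))) ≡ δ ∧ᵇ (e ∧ᵇ f)
meetBit-semidistrib false _     _     _     _     _    _  = refl
meetBit-semidistrib true  _     false _     _     _    _  = refl
meetBit-semidistrib true  false true  true  _     _    _  = refl
meetBit-semidistrib true  true  true  true  _     _    _  = refl
meetBit-semidistrib true  true  true  false false _    _  = refl
meetBit-semidistrib true  false true  false false side _  = ⊥-elim (side _ _)
meetBit-semidistrib true  _     true  false true  _    ()

module Doubling (K : FinLattice) {C : Fin (FinLattice.size K) → Set}
                (C? : U.Decidable C) (convex : Convex K C) where

  open LatticeProperties K
  open ≡-Reasoning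

  I : Fin size → Set
  I = Ideal poset C

  I? : U.Decidable I
  I? y = Finₚ.any? (λ x → C? x ×-dec y ≤? x)

  I-downward : ∀ {x y} → x ≤ y → I y → I x
  I-downward x≤y (z , Cz , y≤z) = z , Cz , ≤-trans x≤y y≤z

  D : Fin size × Bool → Set
  D = InDoubling poset C

  D? : U.Decidable D
  D? (x , false) = I? x
  D? (x , true)  = ¬? (I? x) ⊎-dec C? x

  C-of-upper : ∀ {x} → D (x , true) → I x → C x
  C-of-upper (inj₁ ¬Ix) Ix = ⊥-elim (¬Ix Ix)
  C-of-upper (inj₂ Cx)  _  = Cx

  upper-upward : ∀ {x y} → D (x , true) → x ≤ y → D (y , true)
  upper-upward {y = y} x∈D x≤y with I? y
  ... | yes Iy  = inj₂ (convex (C-of-upper x∈D (I-downward x≤y Iy)) x≤y Iy)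
  ... | no ¬Iy = inj₁ ¬Iy

  upper-of-T : ∀ {x e} → D (x , e) → T e → D (x , true)
  upper-of-T {e = true} x∈D _ = x∈D

  lower-of-T-not : ∀ {x e} → D (x , e) → T (not e) → I x
  lower-of-T-not {e = false} x∈D _ = x∈D

  infix  4 _⊑_
  infixr 6 _⊔_
  infixr 7 _⊓_

  _⊑_ : Fin size × Bool → Fin size × Bool → Set
  _⊑_ = _≤×_ poset

  ⊑-trans : ∀ {p q r} → p ⊑ q → q ⊑ r → p ⊑ r
  ⊑-trans {_ , _} {_ , _} {_ , _} (x≤y , e≤f) (y≤z , f≤g) = ≤-trans x≤y y≤z , BoolLattice.trans e≤f f≤g

  -- Joins (meets) in L[C] are the coordinatewise ones moved up (down) into L[C].
  ceiling : Fin size × Bool → Fin size × Bool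
  ceiling (x , e) = x , not (isYes (I? x)) ∨ᵇ e

  floor : Fin size × Bool → Fin size × Bool
  floor (x , e) = x , isYes (D? (x , true)) ∧ᵇ e

  ⊑-ceiling : ∀ p → p ⊑ ceiling p
  ⊑-ceiling (x , e) = ≤-refl , BoolLattice.y≤x∨y _ e

  ceiling-least : ∀ {p z} → D z → p ⊑ z → ceiling p ⊑ z
  ceiling-least {x , e} {y , g} z∈D (x≤y , e≤g) with I? x
  ceiling-least {x , e} {y , g}     z∈D (x≤y , e≤g) | yes _  = x≤y , e≤g
  ceiling-least {x , e} {y , true}  z∈D (x≤y , _)   | no _   = x≤y , b≤b
  ceiling-least {x , e} {y , false} z∈D (x≤y , _)   | no ¬Ix = ⊥-elim (¬Ix (I-downward x≤y z∈D))

  floor-⊑ : ∀ p → floor p ⊑ p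
  floor-⊑ (x , e) = ≤-refl , BoolLattice.x∧y≤y _ e

  floor-greatest : ∀ {p z} → D z → z ⊑ p → z ⊑ floor p
  floor-greatest {x , e}    {y , false} _   (y≤x , _)        = y≤x , Boolₚ.≤-minimum _
  floor-greatest {x , true} {y , true}  z∈D (y≤x , b≤b) with I? x | C? x
  ... | no _   | _      = y≤x , b≤b
  ... | yes _  | yes _  = y≤x , b≤b
  ... | yes Ix | no ¬Cx = ⊥-elim (¬Cx (C-of-upper (upper-upward z∈D y≤x) Ix))

  _⊔_ : Op₂ (Fin size × Bool)
  (a , e) ⊔ (b , f) = ceiling (a ∨ b , e ∨ᵇ f)

  _⊓_ : Op₂ (Fin size × Bool)
  (a , e) ⊓ (b , f) = floor (a ∧ b , e ∧ᵇ f)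

  ⊔-upperˡ : ∀ p q → p ⊑ p ⊔ q
  ⊔-upperˡ (a , e) (b , f) = ⊑-trans {a , e} (x≤x∨y a b , BoolLattice.x≤x∨y e f) (⊑-ceiling _)

  ⊔-upperʳ : ∀ p q → q ⊑ p ⊔ q
  ⊔-upperʳ (a , e) (b , f) = ⊑-trans {b , f} (y≤x∨y a b , BoolLattice.y≤x∨y e f) (⊑-ceiling _)

  ⊔-least : ∀ {p q z} → D z → p ⊑ z → q ⊑ z → p ⊔ q ⊑ z
  ⊔-least {a , e} {b , f} {_ , _} z∈D (a≤z , e≤g) (b≤z , f≤g) =
    ceiling-least z∈D (∨-least a≤z b≤z , BoolLattice.∨-least e≤g f≤g)

  ⊓-lowerˡ : ∀ p q → p ⊓ q ⊑ p
  ⊓-lowerˡ (a , e) (b , f) =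
    ⊑-trans {floor (a ∧ b , e ∧ᵇ f)} (floor-⊑ _) (x∧y≤x a b , BoolLattice.x∧y≤x e f)

  ⊓-lowerʳ : ∀ p q → p ⊓ q ⊑ q
  ⊓-lowerʳ (a , e) (b , f) =
    ⊑-trans {floor (a ∧ b , e ∧ᵇ f)} (floor-⊑ _) (x∧y≤y a b , BoolLattice.x∧y≤y e f)

  ⊓-greatest : ∀ {p q z} → D z → z ⊑ p → z ⊑ q → z ⊑ p ⊓ q
  ⊓-greatest {a , e} {b , f} {_ , _} z∈D (z≤a , g≤e) (z≤b , g≤f) =
    floor-greatest z∈D (∧-greatest z≤a z≤b , BoolLattice.∧-greatest g≤e g≤f)

  ceiling-closed : ∀ {x e} → (T e → D (x , true)) → D (ceiling (x , e))
  ceiling-closed {x} {e} h with I? x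
  ceiling-closed {x} {e}     h | no ¬Ix = inj₁ ¬Ix
  ceiling-closed {x} {true}  h | yes _  = h _
  ceiling-closed {x} {false} h | yes Ix = Ix

  floor-closed : ∀ {x e} → (T (not e) → I x) → D (floor (x , e))
  floor-closed {x} {e} h with I? x | C? x
  floor-closed {x} {e}     h | yes Ix | no _   = Ix
  floor-closed {x} {true}  h | yes _  | yes Cx = inj₂ Cx
  floor-closed {x} {false} h | yes Ix | yes _  = Ix
  floor-closed {x} {true}  h | no ¬Ix | _      = inj₁ ¬Ix
  floor-closed {x} {false} h | no _   | _      = h _

  ⊔-closed : ∀ {p q} → D p → D q → D (p ⊔ q)
  ⊔-closed {a , true}  {b , f}     p∈D _   = ceiling-closed λ _ → upper-upward p∈D (x≤x∨y a b)
  ⊔-closed {a , false} {b , true}  _   q∈D = ceiling-closed λ _ → upper-upward q∈D (y≤x∨y a b)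
  ⊔-closed {a , false} {b , false} _   _   = ceiling-closed λ ()

  ⊓-closed : ∀ {p q} → D p → D q → D (p ⊓ q)
  ⊓-closed {a , false} {b , f}     p∈D _   = floor-closed λ _ → I-downward (x∧y≤x a b) p∈D
  ⊓-closed {a , true}  {b , false} _   q∈D = floor-closed λ _ → I-downward (x∧y≤y a b) q∈D
  ⊓-closed {a , true}  {b , true}  _   _   = floor-closed λ ()

  ⊔-semidistrib : JoinSemidistributive _∨_ _∧_ → MeetClosed K C →
                  ∀ p {q r} → D q → D r → p ⊔ q ≡ p ⊔ r → p ⊔ (q ⊓ r) ≡ p ⊔ q
  ⊔-semidistrib sd meetClosed (a , e) {b , f} {c , g} q∈D r∈D eq
    rewrite sd a b c (,-injectiveˡ eq) =
      cong (a ∨ b ,_) (joinBit-semidistrib (isYes (I? (a ∨ b))) (isYes (D? (b ∧ c , true))) e f g side bits)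
    where
    ab≡ac : a ∨ b ≡ a ∨ c
    ab≡ac = ,-injectiveˡ eq

    bits : not (isYes (I? (a ∨ b))) ∨ᵇ (e ∨ᵇ f) ≡ not (isYes (I? (a ∨ b))) ∨ᵇ (e ∨ᵇ g)
    bits = trans (,-injectiveʳ eq) (cong (λ u → not (isYes (I? u)) ∨ᵇ (e ∨ᵇ g)) (sym ab≡ac))

    side : True (I? (a ∨ b)) → T f → T g → True (D? (b ∧ c , true))
    side Iu Tf Tg =
      fromWitness (inj₂ (meetClosed (C-of-upper (upper-of-T q∈D Tf) Ib) (C-of-upper (upper-of-T r∈D Tg) Ic)))
      where
      Ib : I b
      Ib = I-downward (y≤x∨y a b) (toWitness Iu)

      Ic : I c
      Ic = I-downward (subst (c ≤_) (sym ab≡ac) (y≤x∨y a c)) (toWitness Iu)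

  ⊓-semidistrib : MeetSemidistributive _∨_ _∧_ → IdealJoinClosed K C →
                  ∀ p {q r} → D q → D r → p ⊓ q ≡ p ⊓ r → p ⊓ (q ⊔ r) ≡ p ⊓ q
  ⊓-semidistrib sd joinClosed (a , e) {b , f} {c , g} q∈D r∈D eq
    rewrite sd a b c (,-injectiveˡ eq) =
      cong (a ∧ b ,_) (meetBit-semidistrib (isYes (D? (a ∧ b , true))) (isYes (I? (b ∨ c))) e f g side bits)
    where
    ab≡ac : a ∧ b ≡ a ∧ c
    ab≡ac = ,-injectiveˡ eq

    bits : isYes (D? (a ∧ b , true)) ∧ᵇ (e ∧ᵇ f) ≡ isYes (D? (a ∧ b , true)) ∧ᵇ (e ∧ᵇ g)
    bits = trans (,-injectiveʳ eq) (cong (λ w → isYes (D? (w , true)) ∧ᵇ (e ∧ᵇ g)) (sym ab≡ac))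

    side : T (not f) → T (not g) → True (I? (b ∨ c))
    side ¬f ¬g = fromWitness (joinClosed (lower-of-T-not q∈D ¬f) (lower-of-T-not r∈D ¬g))

  module Transport {Q : FinPoset} (iso : IsoToDoubling Q poset C) where
    open FinPoset Q using () renaming (size to m; _≤_ to _≤Q_)

    φ : Fin m → Fin size × Bool
    φ = proj₁ iso

    φ∈D : ∀ q → D (φ q)
    φ∈D = proj₁ (proj₂ iso)

    φ-injective : ∀ q q′ → φ q ≡ φ q′ → q ≡ q′
    φ-injective = proj₁ (proj₂ (proj₂ (proj₂ iso)))

    φ-reflects : ∀ {q q′} → φ q ⊑ φ q′ → q ≤Q q′
    φ-reflects {q} {q′} = Equivalence.from (proj₂ (proj₂ (proj₂ (proj₂ iso))) q q′)

    φ-preserves : ∀ {q q′} → q ≤Q q′ → φ q ⊑ φ q′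
    φ-preserves {q} {q′} = Equivalence.to (proj₂ (proj₂ (proj₂ (proj₂ iso))) q q′)

    preimage : ∀ {p} → D p → ∃ λ q → φ q ≡ p
    preimage {p} = proj₁ (proj₂ (proj₂ iso)) p

    _∨Q_ : Op₂ (Fin m)
    a ∨Q b = proj₁ (preimage (⊔-closed (φ∈D a) (φ∈D b)))

    _∧Q_ : Op₂ (Fin m)
    a ∧Q b = proj₁ (preimage (⊓-closed (φ∈D a) (φ∈D b)))

    φ-∨ : ∀ a b → φ (a ∨Q b) ≡ φ a ⊔ φ b
    φ-∨ a b = proj₂ (preimage (⊔-closed (φ∈D a) (φ∈D b)))

    φ-∧ : ∀ a b → φ (a ∧Q b) ≡ φ a ⊓ φ b
    φ-∧ a b = proj₂ (preimage (⊓-closed (φ∈D a) (φ∈D b)))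

    ∨Q-supremum : Supremum _≤Q_ _∨Q_
    ∨Q-supremum a b =
        φ-reflects (subst (φ a ⊑_) (sym (φ-∨ a b)) (⊔-upperˡ (φ a) (φ b)))
      , φ-reflects (subst (φ b ⊑_) (sym (φ-∨ a b)) (⊔-upperʳ (φ a) (φ b)))
      , λ z a≤z b≤z → φ-reflects (subst (_⊑ φ z) (sym (φ-∨ a b))
                        (⊔-least (φ∈D z) (φ-preserves a≤z) (φ-preserves b≤z)))

    ∧Q-infimum : Infimum _≤Q_ _∧Q_
    ∧Q-infimum a b =
        φ-reflects (subst (_⊑ φ a) (sym (φ-∧ a b)) (⊓-lowerˡ (φ a) (φ b)))
      , φ-reflects (subst (_⊑ φ b) (sym (φ-∧ a b)) (⊓-lowerʳ (φ a) (φ b)))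
      , λ z z≤a z≤b → φ-reflects (subst (φ z ⊑_) (sym (φ-∧ a b))
                        (⊓-greatest (φ∈D z) (φ-preserves z≤a) (φ-preserves z≤b)))

    latticeOn : LatticeOn Q
    latticeOn = record
      { _∨_ = _∨Q_ ; _∧_ = _∧Q_ ; supremum = ∨Q-supremum ; infimum = ∧Q-infimum }

    joinSemidistributive : JoinSemidistributive _∨_ _∧_ → MeetClosed K C →
                           JoinSemidistributive _∨Q_ _∧Q_
    joinSemidistributive sd meetClosed a b c eq = φ-injective _ _ (begin
      φ (a ∨Q (b ∧Q c))  ≡⟨ φ-∨ a (b ∧Q c) ⟩
      φ a ⊔ φ (b ∧Q c)   ≡⟨ cong (φ a ⊔_) (φ-∧ b c) ⟩
      φ a ⊔ (φ b ⊓ φ c)  ≡⟨ ⊔-semidistrib sd meetClosed (φ a) (φ∈D b) (φ∈D c) φ-eq ⟩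
      φ a ⊔ φ b          ≡⟨ φ-∨ a b ⟨
      φ (a ∨Q b)         ∎)
      where
      φ-eq : φ a ⊔ φ b ≡ φ a ⊔ φ c
      φ-eq = trans (sym (φ-∨ a b)) (trans (cong φ eq) (φ-∨ a c))

    meetSemidistributive : MeetSemidistributive _∨_ _∧_ → IdealJoinClosed K C →
                           MeetSemidistributive _∨Q_ _∧Q_
    meetSemidistributive sd joinClosed a b c eq = φ-injective _ _ (begin
      φ (a ∧Q (b ∨Q c))  ≡⟨ φ-∧ a (b ∨Q c) ⟩
      φ a ⊓ φ (b ∨Q c)   ≡⟨ cong (φ a ⊓_) (φ-∨ b c) ⟩
      φ a ⊓ (φ b ⊔ φ c)  ≡⟨ ⊓-semidistrib sd joinClosed (φ a) (φ∈D b) (φ∈D c) φ-eq ⟩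
      φ a ⊓ φ b          ≡⟨ φ-∧ a b ⟨
      φ (a ∧Q b)         ∎)
      where
      φ-eq : φ a ⊓ φ b ≡ φ a ⊓ φ c
      φ-eq = trans (sym (φ-∧ a b)) (trans (cong φ eq) (φ-∧ a c))

Fin1-allEqual : ∀ {n} → n ≡ 1 → (x y : Fin n) → x ≡ y
Fin1-allEqual refl zero zero = refl

singletonLattice : ∀ {P} → FinPoset.size P ≡ 1 → LatticeOn P
singletonLattice {P} size≡1 = record
  { _∨_ = const ; _∧_ = const
  ; supremum = λ x y → all≤ x x , all≤ y x , λ z _ _ → all≤ x z
  ; infimum  = λ x y → all≤ x x , all≤ x y , λ z _ _ → all≤ z x }
  where
  open FinPoset P
  all≤ : ∀ x y → x ≤ y
  all≤ x y = IsPartialOrder.reflexive isPartialOrder (Fin1-allEqual size≡1 x y)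

module DoublingInduction
  {Adm : (P : FinPoset) → (Fin (FinPoset.size P) → Set) → Set}
  (admissible : ∀ {P} (S : LatticeOn P) {C} → Adm P C →
                U.Decidable C × Convex (LatticeOn.finLattice S) C) where

  module DoublingBy {P} (S : LatticeOn P) {C} (adm : Adm P C) =
    Doubling (LatticeOn.finLattice S) (proj₁ (admissible S adm)) (proj₂ (admissible S adm))

  doublingLattice : ∀ {P} → ObtainedByDoublings Adm P → LatticeOn P
  doublingLattice (base P size≡1)         = singletonLattice size≡1
  doublingLattice (step P Q C ob adm iso) = DoublingBy.Transport.latticeOn (doublingLattice ob) adm iso

  doublingLattice-joinSemidistributive :
    (∀ {P} (S : LatticeOn P) {C} → Adm P C → MeetClosed (LatticeOn.finLattice S) C) →
    ∀ {P} (ob : ObtainedByDoublings Adm P) →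
    JoinSemidistributive (LatticeOn._∨_ (doublingLattice ob)) (LatticeOn._∧_ (doublingLattice ob))
  doublingLattice-joinSemidistributive meetClosed (base P _) _ _ _ _ = refl
  doublingLattice-joinSemidistributive meetClosed (step P Q C ob adm iso) =
    DoublingBy.Transport.joinSemidistributive (doublingLattice ob) adm {Q} iso
      (doublingLattice-joinSemidistributive meetClosed ob) (meetClosed (doublingLattice ob) adm)

  doublingLattice-meetSemidistributive :
    (∀ {P} (S : LatticeOn P) {C} → Adm P C → IdealJoinClosed (LatticeOn.finLattice S) C) →
    ∀ {P} (ob : ObtainedByDoublings Adm P) →
    MeetSemidistributive (LatticeOn._∨_ (doublingLattice ob)) (LatticeOn._∧_ (doublingLattice ob))
  doublingLattice-meetSemidistributive joinClosed (base P _) _ _ _ _ = refl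
  doublingLattice-meetSemidistributive joinClosed (step P Q C ob adm iso) =
    DoublingBy.Transport.meetSemidistributive (doublingLattice ob) adm {Q} iso
      (doublingLattice-meetSemidistributive joinClosed ob) (joinClosed (doublingLattice ob) adm)

module _ (K : FinLattice) {C : Fin (FinLattice.size K) → Set} where
  open LatticeProperties K
  open Equivalence

  lowerPseudoInterval-decidable : IsLowerPseudoInterval poset C → U.Decidable C
  lowerPseudoInterval-decidable (m , T , _ , C⇔) x =
    map′ (from (C⇔ x)) (to (C⇔ x)) (m ≤? x ×-dec Finₚ.any? (λ t → t ∈? T ×-dec x ≤? t))

  lowerPseudoInterval-convex : IsLowerPseudoInterval poset C → Convex K C
  lowerPseudoInterval-convex (m , T , _ , C⇔) {x} {y} Cx x≤y (z , Cz , y≤z)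
    with to (C⇔ x) Cx | to (C⇔ z) Cz
  ... | m≤x , _ | _ , t , t∈T , z≤t = from (C⇔ y) (≤-trans m≤x x≤y , t , t∈T , ≤-trans y≤z z≤t)

  lowerPseudoInterval-meetClosed : IsLowerPseudoInterval poset C → MeetClosed K C
  lowerPseudoInterval-meetClosed (m , T , _ , C⇔) {x} {y} Cx Cy
    with to (C⇔ x) Cx | to (C⇔ y) Cy
  ... | m≤x , t , t∈T , x≤t | m≤y , _ =
    from (C⇔ (x ∧ y)) (∧-greatest m≤x m≤y , t , t∈T , ≤-trans (x∧y≤x x y) x≤t)

  upperPseudoInterval-decidable : IsUpperPseudoInterval poset C → U.Decidable C
  upperPseudoInterval-decidable (M , T , _ , C⇔) x =
    map′ (from (C⇔ x)) (to (C⇔ x)) (x ≤? M ×-dec Finₚ.any? (λ t → t ∈? T ×-dec t ≤? x))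

  upperPseudoInterval-convex : IsUpperPseudoInterval poset C → Convex K C
  upperPseudoInterval-convex (M , T , _ , C⇔) {x} {y} Cx x≤y (z , Cz , y≤z)
    with to (C⇔ x) Cx | to (C⇔ z) Cz
  ... | _ , t , t∈T , t≤x | z≤M , _ = from (C⇔ y) (≤-trans y≤z z≤M , t , t∈T , ≤-trans t≤x x≤y)

  upperPseudoInterval-idealJoinClosed : IsUpperPseudoInterval poset C → IdealJoinClosed K C
  upperPseudoInterval-idealJoinClosed (M , T , (t , t∈T , t≤M) , C⇔) (_ , Cx′ , x≤x′) (_ , Cy′ , y≤y′) =
    M , from (C⇔ M) (≤-refl , t , t∈T , t≤M) ,
    ∨-least (≤-trans x≤x′ (below-M Cx′)) (≤-trans y≤y′ (below-M Cy′))
    where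
    below-M : ∀ {z} → C z → z ≤ M
    below-M {z} Cz = proj₁ (to (C⇔ z) Cz)

  interval⇒lowerPseudoInterval : IsInterval poset C → IsLowerPseudoInterval poset C
  interval⇒lowerPseudoInterval (a , b , a≤b , C⇔) =
    a , ⁅ b ⁆ , (b , x∈⁅x⁆ b , a≤b) , λ x → mk⇔
      (λ Cx → proj₁ (to (C⇔ x) Cx) , b , x∈⁅x⁆ b , proj₂ (to (C⇔ x) Cx))
      (λ (a≤x , t , t∈⁅b⁆ , x≤t) →
         from (C⇔ x) (a≤x , subst (x ≤_) (x∈⁅y⁆⇒x≡y b t∈⁅b⁆) x≤t))

  interval⇒upperPseudoInterval : IsInterval poset C → IsUpperPseudoInterval poset C
  interval⇒upperPseudoInterval (a , b , a≤b , C⇔) =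
    b , ⁅ a ⁆ , (a , x∈⁅x⁆ a , a≤b) , λ x → mk⇔
      (λ Cx → proj₂ (to (C⇔ x) Cx) , a , x∈⁅x⁆ a , proj₁ (to (C⇔ x) Cx))
      (λ (x≤b , t , t∈⁅a⁆ , t≤x) →
         from (C⇔ x) (subst (_≤ x) (x∈⁅y⁆⇒x≡y a t∈⁅a⁆) t≤x , x≤b))

lowerPseudoInterval-admissible : ∀ {P} (S : LatticeOn P) {C} → IsLowerPseudoInterval P C →
                                 U.Decidable C × Convex (LatticeOn.finLattice S) C
lowerPseudoInterval-admissible S lpi =
  lowerPseudoInterval-decidable (LatticeOn.finLattice S) lpi , lowerPseudoInterval-convex (LatticeOn.finLattice S) lpi

upperPseudoInterval-admissible : ∀ {P} (S : LatticeOn P) {C} → IsUpperPseudoInterval P C →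
                                 U.Decidable C × Convex (LatticeOn.finLattice S) C
upperPseudoInterval-admissible S upi =
  upperPseudoInterval-decidable (LatticeOn.finLattice S) upi , upperPseudoInterval-convex (LatticeOn.finLattice S) upi

interval-admissible : ∀ {P} (S : LatticeOn P) {C} → IsInterval P C →
                      U.Decidable C × Convex (LatticeOn.finLattice S) C
interval-admissible S ival =
  lowerPseudoInterval-admissible S (interval⇒lowerPseudoInterval (LatticeOn.finLattice S) ival)

supremum-unique : ∀ {A : Set} {_≤_ : A → A → Set} {_∨₁_ _∨₂_ : Op₂ A} → Antisymmetric _≡_ _≤_ →
                  Supremum _≤_ _∨₁_ → Supremum _≤_ _∨₂_ → ∀ x y → x ∨₁ y ≡ x ∨₂ y
supremum-unique antisym sup₁ sup₂ x y =
  antisym (proj₂ (proj₂ (sup₁ x y)) _ (proj₁ (sup₂ x y)) (proj₁ (proj₂ (sup₂ x y))))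
          (proj₂ (proj₂ (sup₂ x y)) _ (proj₁ (sup₁ x y)) (proj₁ (proj₂ (sup₁ x y))))

joinSemidistributive-resp : ∀ {A : Set} {_∨₁_ _∧₁_ _∨₂_ _∧₂_ : Op₂ A} →
                            (∀ x y → x ∨₁ y ≡ x ∨₂ y) → (∀ x y → x ∧₁ y ≡ x ∧₂ y) →
                            JoinSemidistributive _∨₁_ _∧₁_ → JoinSemidistributive _∨₂_ _∧₂_
joinSemidistributive-resp {_∨₁_ = _∨₁_} {_∧₁_} {_∨₂_} {_∧₂_} ∨≡ ∧≡ sd a b c eq = begin
  a ∨₂ (b ∧₂ c)  ≡⟨ ∨≡ a (b ∧₂ c) ⟨
  a ∨₁ (b ∧₂ c)  ≡⟨ cong (a ∨₁_) (∧≡ b c) ⟨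
  a ∨₁ (b ∧₁ c)  ≡⟨ sd a b c (trans (∨≡ a b) (trans eq (sym (∨≡ a c)))) ⟩
  a ∨₁ b         ≡⟨ ∨≡ a b ⟩
  a ∨₂ b         ∎
  where open ≡-Reasoning

module _ (L : FinLattice) (S : LatticeOn (FinLattice.poset L)) where
  open FinLattice L
  open IsLattice isLattice using (antisym; supremum; infimum)

  private
    ∨-agrees : ∀ x y → LatticeOn._∨_ S x y ≡ x ∨ y
    ∨-agrees = supremum-unique antisym (LatticeOn.supremum S) supremum

    ∧-agrees : ∀ x y → LatticeOn._∧_ S x y ≡ x ∧ y
    ∧-agrees = supremum-unique (flip antisym) (LatticeOn.infimum S) infimum

  joinSemidistributive-fromLatticeOn :
    JoinSemidistributive (LatticeOn._∨_ S) (LatticeOn._∧_ S) → JoinSemidistributive _∨_ _∧_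
  joinSemidistributive-fromLatticeOn = joinSemidistributive-resp ∨-agrees ∧-agrees

  meetSemidistributive-fromLatticeOn :
    MeetSemidistributive (LatticeOn._∨_ S) (LatticeOn._∧_ S) → MeetSemidistributive _∨_ _∧_
  meetSemidistributive-fromLatticeOn = joinSemidistributive-resp ∧-agrees ∨-agrees

module _ (L : FinLattice) where
  open FinLattice L

  joinCongruenceUniform⇒joinSemidistributive : JoinCongruenceUniform L → JoinSemidistributive _∨_ _∧_
  joinCongruenceUniform⇒joinSemidistributive jcu = joinSemidistributive-fromLatticeOn L (doublingLattice jcu)
    (doublingLattice-joinSemidistributive (λ S → lowerPseudoInterval-meetClosed (LatticeOn.finLattice S)) jcu)
    where open DoublingInduction lowerPseudoInterval-admissible

  meetCongruenceUniform⇒meetSemidistributive : MeetCongruenceUniform L → MeetSemidistributive _∨_ _∧_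
  meetCongruenceUniform⇒meetSemidistributive mcu = meetSemidistributive-fromLatticeOn L (doublingLattice mcu)
    (doublingLattice-meetSemidistributive (λ S → upperPseudoInterval-idealJoinClosed (LatticeOn.finLattice S)) mcu)
    where open DoublingInduction upperPseudoInterval-admissible

  congruenceUniform⇒joinSemidistributive : CongruenceUniform L → JoinSemidistributive _∨_ _∧_
  congruenceUniform⇒joinSemidistributive cu = joinSemidistributive-fromLatticeOn L (doublingLattice cu)
    (doublingLattice-joinSemidistributive meetClosed cu)
    where
    open DoublingInduction interval-admissible
    meetClosed : ∀ {P} (S : LatticeOn P) {C} → IsInterval P C → MeetClosed (LatticeOn.finLattice S) C
    meetClosed S = lowerPseudoInterval-meetClosed K ∘ interval⇒lowerPseudoInterval K
      where
      K : FinLattice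
      K = LatticeOn.finLattice S

  congruenceUniform⇒meetSemidistributive : CongruenceUniform L → MeetSemidistributive _∨_ _∧_
  congruenceUniform⇒meetSemidistributive cu = meetSemidistributive-fromLatticeOn L (doublingLattice cu)
    (doublingLattice-meetSemidistributive joinClosed cu)
    where
    open DoublingInduction interval-admissible
    joinClosed : ∀ {P} (S : LatticeOn P) {C} → IsInterval P C → IdealJoinClosed (LatticeOn.finLattice S) C
    joinClosed S = upperPseudoInterval-idealJoinClosed K ∘ interval⇒upperPseudoInterval K
      where
      K : FinLattice
      K = LatticeOn.finLattice S

-- Counting

module _ {P : FinPoset} {Q : Fin (FinPoset.size P) → Set} where
  open FinPoset P using (size)
  open Equivalence

  enumeration⇒count : ∀ {n} (f : Fin n → Fin size) → (∀ {i j} → f i ≡ f j → i ≡ j) →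
                      (∀ x → Q x ⇔ ∃ λ i → f i ≡ x) → CountIs P Q n
  enumeration⇒count f f-inj Q⇔image =
    tabulate f , length-tabulate f , tabulate⁺ f-inj , λ x → mk⇔
      (λ x∈ → let i , x≡fi = ∈-tabulate⁻ x∈ in from (Q⇔image x) (i , sym x≡fi))
      (λ Qx → let i , fi≡x = to (Q⇔image x) Qx in subst (_∈ tabulate f) fi≡x (∈-tabulate⁺ i))

  injection≤count : ∀ {m n} → CountIs P Q n → (f : Fin m → Fin size) → (∀ i → Q (f i)) →
                    (∀ {i j} → f i ≡ f j → i ≡ j) → m ℕ.≤ n
  injection≤count (xs , refl , _ , xs⇔Q) f Qf f-inj = Finₚ.injective⇒≤ position-injective
    where
    position : ∀ i → f i ∈ xs
    position i = from (xs⇔Q (f i)) (Qf i)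

    position-injective : ∀ {i j} → Any.index (position i) ≡ Any.index (position j) → i ≡ j
    position-injective {i} {j} eq = f-inj (begin
      f i                              ≡⟨ lookup-index (position i) ⟩
      lookup xs (Any.index (position i)) ≡⟨ cong (lookup xs) eq ⟩
      lookup xs (Any.index (position j)) ≡⟨ lookup-index (position j) ⟨
      f j                              ∎)
      where open ≡-Reasoning

  injection-surjective : ∀ {n} → CountIs P Q n → (f : Fin n → Fin size) → (∀ i → Q (f i)) →
                         (∀ {i j} → f i ≡ f j → i ≡ j) → ∀ x → Q x → ∃ λ i → f i ≡ x
  injection-surjective {n} count f Qf f-inj x Qx with Finₚ.any? (λ i → f i ≟ x)
  ... | yes hit = hit
  ... | no miss = ⊥-elim (ℕₚ.<-irrefl refl (injection≤count count g Qg g-inj))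
    where
    g : Fin (ℕ.suc n) → Fin size
    g zero    = x
    g (suc i) = f i

    Qg : ∀ i → Q (g i)
    Qg zero    = Qx
    Qg (suc i) = Qf i

    g-inj : ∀ {i j} → g i ≡ g j → i ≡ j
    g-inj {zero}  {zero}  _  = refl
    g-inj {zero}  {suc j} eq = ⊥-elim (miss (j , sym eq))
    g-inj {suc i} {zero}  eq = ⊥-elim (miss (i , eq))
    g-inj {suc i} {suc j} eq = cong suc (f-inj eq)

  count-resp : ∀ {R : Fin size → Set} {n} → (∀ x → Q x ⇔ R x) → CountIs P Q n → CountIs P R n
  count-resp Q⇔R (xs , len , unique , xs⇔Q) = xs , len , unique , λ x → ⇔-trans (xs⇔Q x) (Q⇔R x)

-- Chains

firstChange : ∀ {k} {P : Fin (ℕ.suc k) → Set} → U.Decidable P → ¬ P zero → P (fromℕ k) →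
              ∃ λ i → ¬ P (inject₁ i) × P (suc i)
firstChange {ℕ.zero}  P? ¬P₀ Pₖ = ⊥-elim (¬P₀ Pₖ)
firstChange {ℕ.suc k} P? ¬P₀ Pₖ with P? (suc zero)
... | yes P₁ = zero , ¬P₀ , P₁
... | no ¬P₁ = let i , ¬Pᵢ , Pᵢ₊₁ = firstChange (P? ∘ suc) ¬P₁ Pₖ in suc i , ¬Pᵢ , Pᵢ₊₁

suc≤inject₁ : ∀ {k} {i j : Fin k} → i Fin.< j → suc i Fin.≤ inject₁ j
suc≤inject₁ {j = j} i<j = subst (ℕ._≤_ _) (sym (Finₚ.toℕ-inject₁ j)) i<j

≤inject₁⊎suc≤ : ∀ {k} (r : Fin (ℕ.suc k)) (i : Fin k) → r Fin.≤ inject₁ i ⊎ suc i Fin.≤ r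
≤inject₁⊎suc≤ r i with ℕₚ.≤-<-connex (Fin.toℕ r) (Fin.toℕ i)
... | inj₁ r≤i = inj₁ (subst (ℕ._≤_ _) (sym (Finₚ.toℕ-inject₁ i)) r≤i)
... | inj₂ i<r = inj₂ i<r

opposite-< : ∀ {n} {i j : Fin n} → i Fin.< j → Fin.opposite j Fin.< Fin.opposite i
opposite-< {i = i} {j} i<j =
  subst₂ ℕ._<_ (sym (Finₚ.opposite-prop j)) (sym (Finₚ.opposite-prop i))
         (ℕₚ.∸-monoʳ-< (ℕ.s≤s i<j) (Finₚ.toℕ<n j))

module ChainProperties (L : FinLattice) {k} (c : Fin (ℕ.suc k) → Fin (FinLattice.size L))
                       (increasing : ∀ i j → i Fin.< j → LatticeProperties._<_ L (c i) (c j)) where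

  open LatticeProperties L

  monotone : ∀ {i j} → i Fin.≤ j → c i ≤ c j
  monotone {i} {j} i≤j with i ≟ j
  ... | yes refl = ≤-refl
  ... | no i≢j  = proj₁ (increasing i j (Finₚ.≤∧≢⇒< i≤j i≢j))

  step-< : ∀ i → c (inject₁ i) < c (suc i)
  step-< i = increasing _ _ (Finₚ.≤̄⇒inject₁< Finₚ.≤-refl)

  StepOf : Fin size → Fin k → Set
  StepOf x i = ¬ x ≤ c (inject₁ i) × x ≤ c (suc i)

  stepOf-unique : ∀ {x i i′} → StepOf x i → StepOf x i′ → i ≡ i′
  stepOf-unique {i = i} {i′} (x≰cᵢ , x≤cᵢ₊₁) (x≰cᵢ′ , x≤cᵢ′₊₁) with Finₚ.<-cmp i i′
  ... | tri< i<i′ _ _ = ⊥-elim (x≰cᵢ′ (≤-trans x≤cᵢ₊₁ (monotone (suc≤inject₁ i<i′))))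
  ... | tri≈ _ i≡i′ _ = i≡i′
  ... | tri> _ _ i′<i = ⊥-elim (x≰cᵢ (≤-trans x≤cᵢ′₊₁ (monotone (suc≤inject₁ i′<i))))

  stepOf-exists : ∀ {x} → ¬ x ≤ c zero → x ≤ c (fromℕ k) → ∃ (StepOf x)
  stepOf-exists {x} = firstChange (λ r → x ≤? c r)

  label : Fin k → Fin size
  label i = proj₁ (minimalNotBelow-exists (<⇒≱ (step-< i)))

  label-minimal : ∀ i → MinimalNotBelow (c (inject₁ i)) (label i)
  label-minimal i = proj₂ (proj₂ (minimalNotBelow-exists (<⇒≱ (step-< i))))

  label-stepOf : ∀ i → StepOf (label i) i
  label-stepOf i = proj₁ (label-minimal i) , proj₁ (proj₂ (minimalNotBelow-exists (<⇒≱ (step-< i))))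

  label-joinIrreducible : ∀ i → JoinIrreducible poset (label i)
  label-joinIrreducible i = minimalNotBelow⇒joinIrreducible (label-minimal i)

  label-injective : ∀ {i j} → label i ≡ label j → i ≡ j
  label-injective {i} {j} eq = stepOf-unique (label-stepOf i) (subst (λ x → StepOf x j) (sym eq) (label-stepOf j))

  length≤joinIrreducibles : ∀ {n} → CountIs poset (JoinIrreducible poset) n → k ℕ.≤ n
  length≤joinIrreducibles count = injection≤count {P = poset} count label label-joinIrreducible label-injective

  module Separating
    (has-step  : ∀ {j} → JoinIrreducible poset j → ∃ (StepOf j))
    (same-step : ∀ {i j j′} → JoinIrreducible poset j → JoinIrreducible poset j′ →
                 StepOf j i → StepOf j′ i → j ≡ j′) where

    no-bottom-outside : ∀ {z} → ¬ (∃ λ r → c r ≡ z) → z ≤ c zero → ⊥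
    no-bottom-outside ∉chain z≤c₀ =
      let j , ji , j≤c₀ , _ = joinIrreducible-separates (λ c₀≤z → ∉chain (zero , ≤-antisym c₀≤z z≤c₀))
          i , j≰cᵢ , _      = has-step ji
      in  j≰cᵢ (≤-trans j≤c₀ (monotone ℕ.z≤n))

    no-top-outside : ∀ {z} → ¬ z ≤ c (fromℕ k) → ⊥
    no-top-outside z≰cₖ =
      let j , ji , _ , j≰cₖ = joinIrreducible-separates z≰cₖ
          i , _ , j≤cᵢ₊₁    = has-step ji
      in  j≰cₖ (≤-trans j≤cᵢ₊₁ (monotone (Finₚ.≤fromℕ _)))

    no-step-outside : ∀ {z i} → (∀ r → z ≤ c r ⊎ c r ≤ z) → ¬ (∃ λ r → c r ≡ z) → StepOf z i → ⊥
    no-step-outside {z} {i} comparable ∉chain (z≰cᵢ , z≤cᵢ₊₁) =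
      let j₁ , ji₁ , j₁≤z , j₁≰cᵢ     = joinIrreducible-separates z≰cᵢ
          j₂ , ji₂ , j₂≤cᵢ₊₁ , j₂≰z   = joinIrreducible-separates cᵢ₊₁≰z
          j₁≡j₂ = same-step ji₁ ji₂ (j₁≰cᵢ , ≤-trans j₁≤z z≤cᵢ₊₁)
                                    (j₂≰z ∘ flip ≤-trans cᵢ≤z , j₂≤cᵢ₊₁)
      in  j₂≰z (subst (_≤ z) j₁≡j₂ j₁≤z)
      where
      cᵢ≤z : c (inject₁ i) ≤ z
      cᵢ≤z = [ ⊥-elim ∘ z≰cᵢ , id ] (comparable (inject₁ i))

      cᵢ₊₁≰z : ¬ c (suc i) ≤ z
      cᵢ₊₁≰z cᵢ₊₁≤z = ∉chain (suc i , ≤-antisym cᵢ₊₁≤z z≤cᵢ₊₁)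

    maximal : IsMaximalChain poset k (c , increasing)
    maximal z comparable with Finₚ.any? (λ r → c r ≟ z)
    ... | yes in-chain = in-chain
    ... | no ∉chain with z ≤? c zero | z ≤? c (fromℕ k)
    ...   | yes z≤c₀ | _        = ⊥-elim (no-bottom-outside ∉chain z≤c₀)
    ...   | no _     | no z≰cₖ  = ⊥-elim (no-top-outside z≰cₖ)
    ...   | no z≰c₀  | yes z≤cₖ =
      ⊥-elim (no-step-outside comparable ∉chain (proj₂ (stepOf-exists z≰c₀ z≤cₖ)))

  module Maximal (maximal : IsMaximalChain poset k (c , increasing)) where

    bottom : ∀ x → c zero ≤ x
    bottom x =
      let r , cᵣ≡c₀∧x = maximal (c zero ∧ x) (λ i → inj₁ (≤-trans (x∧y≤x _ x) (monotone ℕ.z≤n)))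
      in  ≤-trans (monotone {zero} {r} ℕ.z≤n) (subst (_≤ x) (sym cᵣ≡c₀∧x) (x∧y≤y _ x))

    top : ∀ x → x ≤ c (fromℕ k)
    top x =
      let r , cᵣ≡cₖ∨x = maximal (c (fromℕ k) ∨ x)
                                (λ i → inj₂ (≤-trans (monotone (Finₚ.≤fromℕ i)) (x≤x∨y _ x)))
      in  ≤-trans (subst (x ≤_) (sym cᵣ≡cₖ∨x) (y≤x∨y _ x)) (monotone (Finₚ.≤fromℕ r))

    cover : ∀ i → c (inject₁ i) ⋖ c (suc i)
    cover i = step-< i , λ z (cᵢ<z , z<cᵢ₊₁) →
      in-chain z (maximal z (comparable cᵢ<z z<cᵢ₊₁)) (cᵢ<z , z<cᵢ₊₁)
      where
      comparable : ∀ {z} → c (inject₁ i) < z → z < c (suc i) → ∀ r → z ≤ c r ⊎ c r ≤ z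
      comparable cᵢ<z z<cᵢ₊₁ r with ≤inject₁⊎suc≤ r i
      ... | inj₁ r≤i   = inj₂ (≤-trans (monotone r≤i) (proj₁ cᵢ<z))
      ... | inj₂ i+1≤r = inj₁ (≤-trans (proj₁ z<cᵢ₊₁) (monotone i+1≤r))

      in-chain : ∀ z → (∃ λ r → c r ≡ z) → ¬ (c (inject₁ i) < z × z < c (suc i))
      in-chain z (r , cᵣ≡z) (cᵢ<z , z<cᵢ₊₁) with ≤inject₁⊎suc≤ r i
      ... | inj₁ r≤i   = <⇒≱ cᵢ<z (subst (_≤ c (inject₁ i)) cᵣ≡z (monotone r≤i))
      ... | inj₂ i+1≤r = <⇒≱ z<cᵢ₊₁ (subst (c (suc i) ≤_) cᵣ≡z (monotone i+1≤r))

    joinIrreducible-stepOf : ∀ {j} → JoinIrreducible poset j → ∃ (StepOf j)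
    joinIrreducible-stepOf (_ , j₊⋖j , _) =
      stepOf-exists (λ j≤c₀ → <⇒≱ (proj₁ j₊⋖j) (≤-trans j≤c₀ (bottom _))) (top _)

-- From left modularity to extremality

module LeftModularMaximalChain (L : FinLattice)
  (sd : JoinSemidistributive (FinLattice._∨_ L) (FinLattice._∧_ L))
  {k} (c : Fin (ℕ.suc k) → Fin (FinLattice.size L))
  (increasing : ∀ i j → i Fin.< j → LatticeProperties._<_ L (c i) (c j))
  (maximal : IsMaximalChain (FinLattice.poset L) k (c , increasing))
  (leftModular : ∀ i → IsLeftModularElement L (c i)) where

  open LatticeProperties L
  open ChainProperties L c increasing
  open Maximal maximal
  open ≡-Reasoning

  step-join : ∀ {i j} → StepOf j i → c (inject₁ i) ∨ j ≡ c (suc i)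
  step-join {i} (j≰cᵢ , j≤cᵢ₊₁) = cover-join (cover i) j≰cᵢ j≤cᵢ₊₁

  lowerCover≤step : ∀ {i j} (ji : JoinIrreducible poset j) → StepOf j i → proj₁ ji ≤ c (inject₁ i)
  lowerCover≤step {i} {j} ji@(j₊ , j₊⋖j , _) (j≰cᵢ , j≤cᵢ₊₁) =
    ≤-stable λ j₊≰cᵢ → <-irrefl (sym (j≡j₊ j₊≰cᵢ)) (proj₁ j₊⋖j)
    where
    j≡j₊ : ¬ j₊ ≤ c (inject₁ i) → j ≡ j₊
    j≡j₊ j₊≰cᵢ = begin
      j                          ≡⟨ y≤x⇒x∧y≈y j≤cᵢ₊₁ ⟨
      c (suc i) ∧ j              ≡⟨ cong (_∧ j) cᵢ₊₁≡j₊∨cᵢ ⟩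
      (j₊ ∨ c (inject₁ i)) ∧ j   ≡⟨ leftModular (inject₁ i) j₊ j (proj₁ j₊⋖j) ⟩
      j₊ ∨ (c (inject₁ i) ∧ j)   ≡⟨ y≤x⇒x∨y≡x (joinIrreducible-below ji _ (x∧y<y j≰cᵢ)) ⟩
      j₊                         ∎
      where
      cᵢ₊₁≡j₊∨cᵢ : c (suc i) ≡ j₊ ∨ c (inject₁ i)
      cᵢ₊₁≡j₊∨cᵢ =
        trans (sym (cover-join (cover i) j₊≰cᵢ (≤-trans (proj₁ (proj₁ j₊⋖j)) j≤cᵢ₊₁))) (∨-comm _ j₊)

  sameStep⇒≤ : ∀ {i j j′} → JoinIrreducible poset j → StepOf j i → StepOf j′ i → j ≤ j′
  sameStep⇒≤ {i} {j} {j′} ji sj sj′ = ≤-stable λ j≰j′ → proj₂ (step-< i) (begin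
    c (inject₁ i)             ≡⟨ y≤x⇒x∨y≡x (j∧j′≤cᵢ j≰j′) ⟨
    c (inject₁ i) ∨ (j ∧ j′)  ≡⟨ sd _ j j′ (trans (step-join sj) (sym (step-join sj′))) ⟩
    c (inject₁ i) ∨ j         ≡⟨ step-join sj ⟩
    c (suc i)                 ∎)
    where
    j∧j′≤cᵢ : ¬ j ≤ j′ → (j ∧ j′) ≤ c (inject₁ i)
    j∧j′≤cᵢ j≰j′ = ≤-trans (joinIrreducible-below ji _ (x∧y<x j≰j′)) (lowerCover≤step ji sj)

  sameStep⇒≡ : ∀ {i j j′} → JoinIrreducible poset j → JoinIrreducible poset j′ →
               StepOf j i → StepOf j′ i → j ≡ j′
  sameStep⇒≡ ji ji′ sj sj′ = ≤-antisym (sameStep⇒≤ ji sj sj′) (sameStep⇒≤ ji′ sj′ sj)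

  joinIrreducible⇔label : ∀ x → JoinIrreducible poset x ⇔ ∃ λ i → label i ≡ x
  joinIrreducible⇔label x = mk⇔
    (λ jx → let i , sx = joinIrreducible-stepOf jx
            in  i , sameStep⇒≡ (label-joinIrreducible i) jx (label-stepOf i) sx)
    (λ (i , labelᵢ≡x) → subst (JoinIrreducible poset) labelᵢ≡x (label-joinIrreducible i))

  joinIrreducible-count : CountIs poset (JoinIrreducible poset) k
  joinIrreducible-count = enumeration⇒count {P = poset} label label-injective joinIrreducible⇔label

  joinExtremal : JoinExtremal poset
  joinExtremal =
    k , ((c , increasing) , λ m (d , d-increasing) →
           ChainProperties.length≤joinIrreducibles L d d-increasing joinIrreducible-count)
      , joinIrreducible-count

leftModular⇒joinExtremal : (L : FinLattice) → JoinSemidistributive (FinLattice._∨_ L) (FinLattice._∧_ L) →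
                           LeftModular L → JoinExtremal (FinLattice.poset L)
leftModular⇒joinExtremal L sd (k , (c , increasing) , maximal , leftModular) =
  LeftModularMaximalChain.joinExtremal L sd c increasing maximal leftModular

module _ (L : FinLattice) where
  open LatticeProperties L
  open DualProperties L

  reverseChain : ∀ {k} → Chain poset k → Chain (FinLattice.poset (dual L)) k
  reverseChain (c , increasing) = c ∘ Fin.opposite , λ i j i<j → >⇒<ᵈ (increasing _ _ (opposite-< i<j))

module _ (L : FinLattice) where
  open LatticeProperties L
  open DualProperties L
  open ≡-Reasoning

  lengthIs-dual : ∀ {k} → LengthIs poset k → LengthIs (FinLattice.poset (dual L)) k
  lengthIs-dual (ch , bound) = reverseChain L ch , λ m chᵈ → bound m (reverseChain (dual L) chᵈ)

  leftModular-dual : LeftModular L → LeftModular (dual L)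
  leftModular-dual (k , (c , increasing) , maximal , leftModular) =
    k , reverseChain L (c , increasing) , maximalᵈ , leftModularᵈ
    where
    maximalᵈ : IsMaximalChain (FinLattice.poset (dual L)) k (reverseChain L (c , increasing))
    maximalᵈ z comparableᵈ =
      let r , cᵣ≡z = maximal z comparable
      in  Fin.opposite r , trans (cong c (Finₚ.opposite-involutive r)) cᵣ≡z
      where
      comparable : ∀ r → z ≤ c r ⊎ c r ≤ z
      comparable r = subst (λ r′ → z ≤ c r′ ⊎ c r′ ≤ z) (Finₚ.opposite-involutive r)
                           (swap (comparableᵈ (Fin.opposite r)))

    leftModularᵈ : ∀ i → IsLeftModularElement (dual L) (c (Fin.opposite i))
    leftModularᵈ i b d b<ᵈd = begin
      (b ∧ a) ∨ d  ≡⟨ ∨-comm _ d ⟩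
      d ∨ (b ∧ a)  ≡⟨ cong (d ∨_) (∧-comm b a) ⟩
      d ∨ (a ∧ b)  ≡⟨ leftModular (Fin.opposite i) d b (<ᵈ⇒> b<ᵈd) ⟨
      (d ∨ a) ∧ b  ≡⟨ ∧-comm _ b ⟩
      b ∧ (d ∨ a)  ≡⟨ cong (b ∧_) (∨-comm d a) ⟩
      b ∧ (a ∨ d)  ∎
      where
      a : Fin size
      a = c (Fin.opposite i)

joinExtremalᵈ⇒meetExtremal : (L : FinLattice) →
                             JoinExtremal (FinLattice.poset (dual L)) → MeetExtremal (FinLattice.poset L)
joinExtremalᵈ⇒meetExtremal L (k , lengthᵈ , countᵈ) =
  k , lengthIs-dual (dual L) lengthᵈ ,
  count-resp {P = FinLattice.poset L} (DualProperties.joinIrreducibleᵈ⇔meetIrreducible L) countᵈ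

leftModular⇒meetExtremal : (L : FinLattice) → MeetSemidistributive (FinLattice._∨_ L) (FinLattice._∧_ L) →
                           LeftModular L → MeetExtremal (FinLattice.poset L)
leftModular⇒meetExtremal L sd lm =
  joinExtremalᵈ⇒meetExtremal L (leftModular⇒joinExtremal (dual L) sd (leftModular-dual L lm))

-- From extremality to left modularity

module CoverLabelling (L : FinLattice) where

  open LatticeProperties L
  open DualProperties L
  open ≡-Reasoning

  Kappa : Fin size → Fin size → Set
  Kappa j m = ¬ j ≤ m × (∀ z → z < j → z ≤ m) × (∀ z → m < z → j ≤ z)

  kappa-of-cover : ∀ {x y j m} → y ⋖ x → j ≤ x → MinimalNotBelow y j →
                   y ≤ m → MaximalNotAbove x m → Kappa j m
  kappa-of-cover y⋖x j≤x (j≰y , below-y) y≤m (x≰m , above-x) =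
      (λ j≤m → x≰m (subst (_≤ _) (cover-join y⋖x j≰y j≤x) (∨-least y≤m j≤m)))
    , (λ z z<j → ≤-trans (below-y z z<j) y≤m)
    , (λ z m<z → ≤-trans j≤x (above-x z m<z))

  kappa-≤ : MeetSemidistributive _∨_ _∧_ → ∀ {j m₁ m₂} → Kappa j m₁ → Kappa j m₂ → m₂ ≤ m₁
  kappa-≤ sd {j} {m₁} {m₂} (j≰m₁ , below₁ , above₁) (j≰m₂ , below₂ , _) =
    ≤-stable λ m₂≰m₁ → j≰m₁ (subst (_≤ m₁) (sym (j≡j∧m₁ m₂≰m₁)) (x∧y≤y j m₁))
    where
    j∧m₁≡j∧m₂ : j ∧ m₁ ≡ j ∧ m₂
    j∧m₁≡j∧m₂ = ≤-antisym (∧-greatest (x∧y≤x j m₁) (below₂ _ (x∧y<x j≰m₁)))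
                          (∧-greatest (x∧y≤x j m₂) (below₁ _ (x∧y<x j≰m₂)))

    j≡j∧m₁ : ¬ m₂ ≤ m₁ → j ≡ j ∧ m₁
    j≡j∧m₁ m₂≰m₁ = begin
      j              ≡⟨ x≤y⇒x∧y≡x (above₁ _ (x<x∨y m₂≰m₁)) ⟨
      j ∧ (m₁ ∨ m₂)  ≡⟨ sd j m₁ m₂ j∧m₁≡j∧m₂ ⟩
      j ∧ m₁         ∎

  kappa-unique : MeetSemidistributive _∨_ _∧_ → ∀ {j m₁ m₂} → Kappa j m₁ → Kappa j m₂ → m₁ ≡ m₂
  kappa-unique sd κ₁ κ₂ = ≤-antisym (kappa-≤ sd κ₂ κ₁) (kappa-≤ sd κ₁ κ₂)

  modularFailure⇒cover : ∀ {a b d} → b ≤ d → (b ∨ a) ∧ d ≢ b ∨ (a ∧ d) →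
                         ∃₂ λ B C → B ⋖ C × (a ∧ C) ≤ B × C ≤ (a ∨ B)
  modularFailure⇒cover {a} {b} {d} b≤d failure =
    let C , B⋖C , C≤D = upperCover-exists (B≤D , failure ∘ sym)
    in  B , C , B⋖C , a∧C≤B C≤D , C≤a∨B C≤D
    where
    B D : Fin size
    B = b ∨ (a ∧ d)
    D = (b ∨ a) ∧ d

    B≤D : B ≤ D
    B≤D = ∨-least (∧-greatest (x≤x∨y b a) b≤d)
                  (∧-greatest (≤-trans (x∧y≤x a d) (y≤x∨y b a)) (x∧y≤y a d))

    a∧C≤B : ∀ {C} → C ≤ D → (a ∧ C) ≤ B
    a∧C≤B {C} C≤D = ≤-trans (∧-greatest (x∧y≤x a C) (≤-trans (x∧y≤y a C) (≤-trans C≤D (x∧y≤y _ d))))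
                            (y≤x∨y b (a ∧ d))

    C≤a∨B : ∀ {C} → C ≤ D → C ≤ (a ∨ B)
    C≤a∨B C≤D = ≤-trans C≤D (≤-trans (x∧y≤x _ d)
                                      (∨-least (≤-trans (x≤x∨y b _) (y≤x∨y a B)) (x≤x∨y a B)))

module ExtremalChain (L : FinLattice)
  (sd : MeetSemidistributive (FinLattice._∨_ L) (FinLattice._∧_ L))
  {k} (c : Fin (ℕ.suc k) → Fin (FinLattice.size L))
  (increasing : ∀ i j → i Fin.< j → LatticeProperties._<_ L (c i) (c j))
  (count : CountIs (FinLattice.poset L) (JoinIrreducible (FinLattice.poset L)) k) where

  open LatticeProperties L
  open DualProperties L
  open CoverLabelling L
  open ChainProperties L c increasing

  label-surjective : ∀ {j} → JoinIrreducible poset j → ∃ λ i → label i ≡ j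
  label-surjective = injection-surjective {P = poset} count label label-joinIrreducible label-injective _

  label≡⇒stepOf : ∀ {i j} → label i ≡ j → StepOf j i
  label≡⇒stepOf {i} labelᵢ≡j = subst (λ x → StepOf x i) labelᵢ≡j (label-stepOf i)

  stepOf⇒label : ∀ {i j} → JoinIrreducible poset j → StepOf j i → label i ≡ j
  stepOf⇒label ji sj =
    let i′ , labelᵢ′≡j = label-surjective ji
    in  trans (cong label (stepOf-unique sj (label≡⇒stepOf labelᵢ′≡j))) labelᵢ′≡j

  maximal : IsMaximalChain poset k (c , increasing)
  maximal = Separating.maximal
    (λ ji → let i , labelᵢ≡j = label-surjective ji in i , label≡⇒stepOf labelᵢ≡j)
    (λ ji ji′ sj sj′ → trans (sym (stepOf⇒label ji sj)) (stepOf⇒label ji′ sj′))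

  open Maximal maximal using (cover)

  label-kappa : ∀ i → ∃ λ m → c (inject₁ i) ≤ m × Kappa (label i) m
  label-kappa i =
    let m , cᵢ≤m , m-max = maximalNotAbove-exists (<⇒≱ (step-< i))
    in  m , cᵢ≤m , kappa-of-cover (cover i) (proj₂ (label-stepOf i)) (label-minimal i) cᵢ≤m m-max

  index≤step : ∀ {i i′ B C} → (c i ∧ C) ≤ B → label i′ ≤ C → ¬ label i′ ≤ B → i Fin.≤ inject₁ i′
  index≤step {i} {i′} cᵢ∧C≤B j≤C j≰B with ≤inject₁⊎suc≤ i i′
  ... | inj₁ i≤i′   = i≤i′
  ... | inj₂ i′+1≤i =
    ⊥-elim (j≰B (≤-trans (∧-greatest (≤-trans (proj₂ (label-stepOf i′)) (monotone i′+1≤i)) j≤C) cᵢ∧C≤B))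

  no-straddling-cover : ∀ {i B C} → B ⋖ C → (c i ∧ C) ≤ B → C ≤ (c i ∨ B) → ⊥
  no-straddling-cover {i} {B} {C} B⋖C cᵢ∧C≤B C≤cᵢ∨B =
    let j , j≤C , j-min       = minimalNotBelow-exists C≰B
        m , B≤m , m-max       = maximalNotAbove-exists C≰B
        i′ , labelᵢ′≡j        = label-surjective (minimalNotBelow⇒joinIrreducible j-min)
        m′ , cᵢ′≤m′ , κ′      = label-kappa i′
        m′≡m = kappa-unique sd (subst (λ x → Kappa x m′) labelᵢ′≡j κ′)
                               (kappa-of-cover B⋖C j≤C j-min B≤m m-max)
        i≤i′ = index≤step cᵢ∧C≤B (subst (_≤ C) (sym labelᵢ′≡j) j≤C)
                                  (subst (λ x → ¬ x ≤ B) (sym labelᵢ′≡j) (proj₁ j-min))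
        cᵢ≤m = ≤-trans (monotone i≤i′) (subst (c (inject₁ i′) ≤_) m′≡m cᵢ′≤m′)
    in  proj₁ m-max (≤-trans C≤cᵢ∨B (∨-least cᵢ≤m B≤m))
    where
    C≰B : ¬ C ≤ B
    C≰B = <⇒≱ (proj₁ B⋖C)

  leftModular-element : ∀ i → IsLeftModularElement L (c i)
  leftModular-element i b d b<d = decidable-stable (_ ≟ _) λ failure →
    let B , C , B⋖C , cᵢ∧C≤B , C≤cᵢ∨B = modularFailure⇒cover (proj₁ b<d) failure
    in  no-straddling-cover B⋖C cᵢ∧C≤B C≤cᵢ∨B

  leftModular : LeftModular L
  leftModular = k , (c , increasing) , maximal , leftModular-element

joinExtremal⇒leftModular : (L : FinLattice) → MeetSemidistributive (FinLattice._∨_ L) (FinLattice._∧_ L) →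
                           JoinExtremal (FinLattice.poset L) → LeftModular L
joinExtremal⇒leftModular L sd (k , ((c , increasing) , _) , count) = ExtremalChain.leftModular L sd c increasing count

corollary3p22 : (L : FinLattice) →
    (JoinCongruenceUniform L → LeftModular L → JoinExtremal (FinLattice.poset L)) ×
    (MeetCongruenceUniform L → LeftModular L → MeetExtremal (FinLattice.poset L)) ×
    (CongruenceUniform L → (Extremal (FinLattice.poset L) ⇔ LeftModular L))
corollary3p22 L =
    (λ jcu → leftModular⇒joinExtremal L (joinCongruenceUniform⇒joinSemidistributive L jcu))
  , (λ mcu → leftModular⇒meetExtremal L (meetCongruenceUniform⇒meetSemidistributive L mcu))
  , λ cu → mk⇔
      (λ (joinExtremal , _) → joinExtremal⇒leftModular L (congruenceUniform⇒meetSemidistributive L cu) joinExtremal)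
      (λ lm → leftModular⇒joinExtremal L (congruenceUniform⇒joinSemidistributive L cu) lm
            , leftModular⇒meetExtremal L (congruenceUniform⇒meetSemidistributive L cu) lm)
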